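{- Let $(C_n)_{n\ge 0}$ satisfy $C_0=C_1=0$ and, for $n\ge 2$, $C_n\stackrel{d}{=}C_{U_n-1}+C^{\star}_{n-U_n}+n-1$, with $U_n$ uniform on $\{1,\dots,n\}$ and, conditionally on $U_n$, the two summands independent copies from the family $(C_m)_m$. Let $(C_{n,2})_{n\ge0}$ satisfy $C_{0,2}=C_{1,2}=0$ and, for $n\ge 2$, $C_{n,2}\stackrel{d}{=}(2n-I-2)+C^{(1)}_{I-1,2}+C^{(2)}_{J-I-1,2}+C^{(3)}_{n-J,2}$, with $(I,J)$ uniform over pairs $1\le I<J\le n$ and, conditionally on $(I,J)$, the three summands independent copies from the family $(C_{m,2})_m$. Then for every $n\ge 0$, $C_{n,2}$ and $C_n$ have the same distribution.
   Context: $C_n$ is the number of comparisons of ordinary randomised Quicksort (one uniformly random pivot per stage) and $C_{n,2}$ that of dual pivot Quicksort, on $n$ distinct keys. -}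

module Defs where

open import Data.Nat using (ℕ; zero; suc; _∸_) renaming (_+_ to _+ℕ_; _*_ to _*ℕ_)
open import Data.Integer using (+_)
open import Data.Rational using (ℚ; 0ℚ; 1ℚ; _+_; _*_; _/_)
open import Data.Product using (_×_; _,_)
open import Data.List using (List; []; _∷_; _++_; [_]; map; foldr; upTo; concatMap)

-- A (finitely supported) probability law on ℕ, given by its mass function:
-- Dist D k = P(X = k).
Dist : Set
Dist = ℕ → ℚ

sumℚ : List ℚ → ℚ
sumℚ = foldr _+_ 0ℚ

δ₀ : Dist
δ₀ zero    = 1ℚ
δ₀ (suc _) = 0ℚ

shift : ℕ → Dist → Dist
shift zero    D k       = D k
shift (suc s) D zero    = 0ℚ
shift (suc s) D (suc k) = shift s D k

-- law of X + Y for independent X ~ D, Y ~ E.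
conv : Dist → Dist → Dist
conv D E k = sumℚ (map (λ a → D a * E (k ∸ a)) (upTo (suc k)))

scale : ℚ → Dist → Dist
scale q D k = q * D k

sumD : List Dist → Dist
sumD Ds k = sumℚ (map (λ D → D k) Ds)

between : ℕ → ℕ → List ℕ
between a b = map (a +ℕ_) (upTo (b ∸ a))

-- i-th entry of a list of laws (default δ₀, never used below).
get : List Dist → ℕ → Dist
get []       _       = δ₀
get (D ∷ _)  zero    = D
get (_ ∷ Ds) (suc i) = get Ds i

-- Ordinary Quicksort: law of C_n, given the list [law C_0, …, law C_{n-1}].
-- C_n = C_{U-1} + C*_{n-U} + n - 1, U uniform on {1..n}.

stepQ : ℕ → List Dist → Dist
stepQ zero          _ = δ₀
stepQ (suc zero)    _ = δ₀
stepQ n@(suc (suc m)) h =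
  scale ((+ 1) / n)
    (sumD (map (λ u → shift (n ∸ 1) (conv (get h (u ∸ 1)) (get h (n ∸ u))))
               (between 1 (suc n))))

histQ : ℕ → List Dist
histQ zero    = []
histQ (suc n) = histQ n ++ [ stepQ n (histQ n) ]

lawC : ℕ → Dist
lawC n = stepQ n (histQ n)

-- Dual pivot Quicksort:
-- C_{n,2} = (2n - I - 2) + C⁽¹⁾_{I-1,2} + C⁽²⁾_{J-I-1,2} + C⁽³⁾_{n-J,2},
-- (I,J) uniform on pairs 1 ≤ I < J ≤ n (there are n(n-1)/2 of them).

pairs : ℕ → List (ℕ × ℕ)
pairs n = concatMap (λ i → map (λ j → (i , j)) (between (suc i) (suc n))) (between 1 (suc n))

stepD : ℕ → List Dist → Dist
stepD zero          _ = δ₀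
stepD (suc zero)    _ = δ₀
stepD n@(suc (suc m)) h =
  scale ((+ 2) / (n *ℕ (n ∸ 1)))
    (sumD (map (λ { (i , j) →
                 shift ((2 *ℕ n) ∸ i ∸ 2)
                   (conv (conv (get h (i ∸ 1)) (get h (j ∸ i ∸ 1))) (get h (n ∸ j))) })
               (pairs n)))

histD : ℕ → List Dist
histD zero    = []
histD (suc n) = histD n ++ [ stepD n (histD n) ]

lawC₂ : ℕ → Dist
lawC₂ n = stepD n (histD n)

module Submission where

-- Write Lₙ for the law of Cₙ, so that n·Lₙ = Σ_{t<n} δ_{n-1} ∗ L_t ∗ L_{n-1-t}.  Splitting the
-- weight n-1 = (n-1-t) + t and using the symmetry t ↔ n-1-t gives
-- (n-1)·n·Lₙ = 2 Σ_t δ_{n-1} ∗ L_t ∗ (n-1-t)·L_{n-1-t}, and expanding (n-1-t)·L_{n-1-t} once more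
-- by the recurrence yields 2 Σ_{t,r} δ_{2n-3-t} ∗ L_t ∗ L_r ∗ L_{n-2-t-r}.  That is n(n-1)/2 times
-- the dual pivot recurrence, so the Lₙ solve it, and the two families agree by strong induction.

open import Defs
open import Algebra.Bundles using (CommutativeMonoid)
open import Data.Integer.Base as ℤ using ()
import Data.Integer.Properties as ℤ
open import Data.List.Base using (List; []; _∷_; _++_; [_]; map; upTo; applyUpTo; concatMap; length)
open import Data.List.Properties using (map-∘; map-++; length-++)
open import Data.Nat.Base as ℕ using (ℕ; zero; suc; _∸_; _<_; _≤_; z≤n; s≤s)
open import Data.Nat.Induction using (<-rec)
import Data.Nat.Properties as ℕ
open import Data.Nat.Tactic.RingSolver using (solve-∀)
open import Data.Product.Base using (_×_; _,_)
open import Data.Rational.Base using (ℚ; 0ℚ; 1ℚ; _+_; _*_; _/_; toℚᵘ)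
open import Data.Rational.Properties
open import Data.Rational.Solver using (module +-*-Solver)
open import Data.Rational.Unnormalised.Base as ℚᵘ using ()
import Data.Rational.Unnormalised.Properties as ℚᵘ
open import Data.Sum.Base using (inj₁; inj₂)
open import Function.Base using (_∘_; id)
open import Relation.Binary.PropositionalEquality hiding ([_])

open import Algebra.Properties.CommutativeSemigroup (CommutativeMonoid.commutativeSemigroup +-0-commutativeMonoid)
  using (interchange)
open +-*-Solver using (solve; _:*_; _:=_)
open ≡-Reasoning

∑ : ℕ → (ℕ → ℚ) → ℚ
∑ zero    f = 0ℚ
∑ (suc n) f = f 0 + ∑ n (f ∘ suc)

∑-cong : ∀ n {f g : ℕ → ℚ} → (∀ t → t < n → f t ≡ g t) → ∑ n f ≡ ∑ n g
∑-cong zero    f≡g = refl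
∑-cong (suc n) f≡g = cong₂ _+_ (f≡g 0 (s≤s z≤n)) (∑-cong n (λ t t<n → f≡g (suc t) (s≤s t<n)))

∑-zero : ∀ n → ∑ n (λ _ → 0ℚ) ≡ 0ℚ
∑-zero zero    = refl
∑-zero (suc n) = trans (+-identityˡ _) (∑-zero n)

∑-distrib-+ : ∀ n (f g : ℕ → ℚ) → ∑ n (λ t → f t + g t) ≡ ∑ n f + ∑ n g
∑-distrib-+ zero    f g = refl
∑-distrib-+ (suc n) f g =
  trans (cong ((f 0 + g 0) +_) (∑-distrib-+ n (f ∘ suc) (g ∘ suc)))
        (interchange (f 0) (g 0) (∑ n (f ∘ suc)) (∑ n (g ∘ suc)))

*-distribˡ-∑ : ∀ n q (f : ℕ → ℚ) → q * ∑ n f ≡ ∑ n (λ t → q * f t)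
*-distribˡ-∑ zero    q f = *-zeroʳ q
*-distribˡ-∑ (suc n) q f =
  trans (*-distribˡ-+ q (f 0) (∑ n (f ∘ suc))) (cong (q * f 0 +_) (*-distribˡ-∑ n q (f ∘ suc)))

∑-comm : ∀ n p (f : ℕ → ℕ → ℚ) → ∑ n (λ a → ∑ p (f a)) ≡ ∑ p (λ r → ∑ n (λ a → f a r))
∑-comm zero    p f = sym (∑-zero p)
∑-comm (suc n) p f =
  trans (cong (∑ p (f 0) +_) (∑-comm n p (f ∘ suc)))
        (sym (∑-distrib-+ p (f 0) (λ r → ∑ n (λ a → f (suc a) r))))

∑-snoc : ∀ n (f : ℕ → ℚ) → ∑ (suc n) f ≡ ∑ n f + f n
∑-snoc zero    f = trans (+-identityʳ (f 0)) (sym (+-identityˡ (f 0)))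
∑-snoc (suc n) f =
  trans (cong (f 0 +_) (∑-snoc n (f ∘ suc))) (sym (+-assoc (f 0) (∑ n (f ∘ suc)) (f (suc n))))

∑-reverse : ∀ m (f : ℕ → ℚ) → ∑ (suc m) f ≡ ∑ (suc m) (λ t → f (m ∸ t))
∑-reverse zero    f = refl
∑-reverse (suc m) f = begin
  f 0 + ∑ (suc m) (f ∘ suc)                   ≡⟨ cong (f 0 +_) (∑-reverse m (f ∘ suc)) ⟩
  f 0 + ∑ (suc m) (λ t → f (suc (m ∸ t)))     ≡⟨ +-comm (f 0) _ ⟩
  ∑ (suc m) (λ t → f (suc (m ∸ t))) + f 0     ≡⟨ cong₂ _+_ (∑-cong (suc m) (λ t t<1+m → cong f (sym (ℕ.+-∸-assoc 1 (ℕ.≤-pred t<1+m)))))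
                                                            (cong f (sym (ℕ.n∸n≡0 (suc m)))) ⟩
  ∑ (suc m) (λ t → f (suc m ∸ t)) + f (suc m ∸ suc m) ≡⟨ sym (∑-snoc (suc m) (λ t → f (suc m ∸ t))) ⟩
  ∑ (suc (suc m)) (λ t → f (suc m ∸ t))       ∎

sumℚ-map-applyUpTo : ∀ n (f : ℕ → ℚ) (g : ℕ → ℕ) → sumℚ (map f (applyUpTo g n)) ≡ ∑ n (f ∘ g)
sumℚ-map-applyUpTo zero    f g = refl
sumℚ-map-applyUpTo (suc n) f g = cong (f (g 0) +_) (sumℚ-map-applyUpTo n f (g ∘ suc))

sumℚ-map-between : ∀ a b (f : ℕ → ℚ) → sumℚ (map f (between a b)) ≡ ∑ (b ∸ a) (λ t → f (a ℕ.+ t))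
sumℚ-map-between a b f = trans (cong sumℚ (sym (map-∘ (upTo (b ∸ a)))))
                               (sumℚ-map-applyUpTo (b ∸ a) (λ t → f (a ℕ.+ t)) id)

sumℚ-++ : ∀ xs ys → sumℚ (xs ++ ys) ≡ sumℚ xs + sumℚ ys
sumℚ-++ []       ys = sym (+-identityˡ _)
sumℚ-++ (x ∷ xs) ys = trans (cong (x +_) (sumℚ-++ xs ys)) (sym (+-assoc x _ _))

sumℚ-map-concatMap : ∀ {A B : Set} (f : B → ℚ) (h : A → List B) xs →
  sumℚ (map f (concatMap h xs)) ≡ sumℚ (map (λ x → sumℚ (map f (h x))) xs)
sumℚ-map-concatMap f h []       = refl
sumℚ-map-concatMap f h (x ∷ xs) = begin
  sumℚ (map f (h x ++ concatMap h xs))                ≡⟨ cong sumℚ (map-++ f (h x) _) ⟩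
  sumℚ (map f (h x) ++ map f (concatMap h xs))        ≡⟨ sumℚ-++ (map f (h x)) _ ⟩
  sumℚ (map f (h x)) + sumℚ (map f (concatMap h xs))  ≡⟨ cong (sumℚ (map f (h x)) +_) (sumℚ-map-concatMap f h xs) ⟩
  sumℚ (map f (h x)) + sumℚ (map (λ x → sumℚ (map f (h x))) xs) ∎

sumℚ-map-pairs : ∀ n (f : ℕ × ℕ → ℚ) →
  sumℚ (map f (pairs n)) ≡ ∑ n (λ t → ∑ (n ∸ suc t) (λ r → f (suc t , suc (suc t) ℕ.+ r)))
sumℚ-map-pairs n f = begin
  sumℚ (map f (pairs n))
    ≡⟨ sumℚ-map-concatMap f row (between 1 (suc n)) ⟩
  sumℚ (map (λ i → sumℚ (map f (row i))) (between 1 (suc n)))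
    ≡⟨ sumℚ-map-between 1 (suc n) _ ⟩
  ∑ n (λ t → sumℚ (map f (row (suc t))))
    ≡⟨ ∑-cong n (λ t _ → trans (cong sumℚ (sym (map-∘ (between (suc (suc t)) (suc n)))))
                               (sumℚ-map-between (suc (suc t)) (suc n) _)) ⟩
  ∑ n (λ t → ∑ (n ∸ suc t) (λ r → f (suc t , suc (suc t) ℕ.+ r))) ∎
  where
  row : ℕ → List (ℕ × ℕ)
  row i = map (i ,_) (between (suc i) (suc n))

∑anti : ℕ → (ℕ → ℕ → ℚ) → ℚ
∑anti k f = ∑ (suc k) (λ a → f a (k ∸ a))

∑anti-cong : ∀ k {f g : ℕ → ℕ → ℚ} → (∀ a b → f a b ≡ g a b) → ∑anti k f ≡ ∑anti k g
∑anti-cong k f≡g = ∑-cong (suc k) (λ a _ → f≡g a (k ∸ a))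

∑anti-assoc : ∀ k (f : ℕ → ℕ → ℕ → ℚ) →
  ∑anti k (λ x c → ∑anti x (λ a b → f a b c)) ≡ ∑anti k (λ a y → ∑anti y (f a))
∑anti-assoc zero    f = refl
∑anti-assoc (suc k) f = begin
  (f 0 0 (suc k) + 0ℚ) + ∑anti k (λ x c → f 0 (suc x) c + ∑anti x (λ a b → f (suc a) b c))
    ≡⟨ cong₂ _+_ (+-identityʳ (f 0 0 (suc k)))
                 (∑-distrib-+ (suc k) (λ x → f 0 (suc x) (k ∸ x)) (λ x → ∑anti x (λ a b → f (suc a) b (k ∸ x)))) ⟩
  f 0 0 (suc k) + (∑anti k (λ x → f 0 (suc x)) + ∑anti k (λ x c → ∑anti x (λ a b → f (suc a) b c)))
    ≡⟨ cong (λ w → f 0 0 (suc k) + (∑anti k (λ x → f 0 (suc x)) + w)) (∑anti-assoc k (f ∘ suc)) ⟩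
  f 0 0 (suc k) + (∑anti k (λ x → f 0 (suc x)) + ∑anti k (λ a y → ∑anti y (f (suc a))))
    ≡⟨ sym (+-assoc (f 0 0 (suc k)) _ _) ⟩
  (f 0 0 (suc k) + ∑anti k (λ x → f 0 (suc x))) + ∑anti k (λ a y → ∑anti y (f (suc a))) ∎

∑D : ℕ → (ℕ → Dist) → Dist
∑D p Ds k = ∑ p (λ r → Ds r k)

conv-∑anti : ∀ D E k → conv D E k ≡ ∑anti k (λ a b → D a * E b)
conv-∑anti D E k = sumℚ-map-applyUpTo (suc k) (λ a → D a * E (k ∸ a)) id

conv-cong : ∀ {D D′ E E′} → D ≗ D′ → E ≗ E′ → conv D E ≗ conv D′ E′
conv-cong {D} {D′} {E} {E′} D≗D′ E≗E′ k = begin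
  conv D E k                  ≡⟨ conv-∑anti D E k ⟩
  ∑anti k (λ a b → D a * E b)   ≡⟨ ∑anti-cong k (λ a b → cong₂ _*_ (D≗D′ a) (E≗E′ b)) ⟩
  ∑anti k (λ a b → D′ a * E′ b) ≡⟨ sym (conv-∑anti D′ E′ k) ⟩
  conv D′ E′ k                ∎

conv-congʳ : ∀ D {E E′} → E ≗ E′ → conv D E ≗ conv D E′
conv-congʳ D = conv-cong {D} {D} (λ _ → refl)

conv-comm : ∀ D E → conv D E ≗ conv E D
conv-comm D E k = begin
  conv D E k                                     ≡⟨ conv-∑anti D E k ⟩
  ∑ (suc k) (λ a → D a * E (k ∸ a))               ≡⟨ ∑-reverse k (λ a → D a * E (k ∸ a)) ⟩
  ∑ (suc k) (λ a → D (k ∸ a) * E (k ∸ (k ∸ a)))   ≡⟨ ∑-cong (suc k) (λ a a<1+k →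
                                                       trans (cong (λ b → D (k ∸ a) * E b) (ℕ.m∸[m∸n]≡n (ℕ.≤-pred a<1+k)))
                                                             (*-comm (D (k ∸ a)) (E a))) ⟩
  ∑ (suc k) (λ a → E a * D (k ∸ a))               ≡⟨ sym (conv-∑anti E D k) ⟩
  conv E D k                                     ∎

conv-assoc : ∀ X Y Z → conv (conv X Y) Z ≗ conv X (conv Y Z)
conv-assoc X Y Z k = begin
  conv (conv X Y) Z k                              ≡⟨ conv-∑anti (conv X Y) Z k ⟩
  ∑anti k (λ x c → conv X Y x * Z c)                 ≡⟨ ∑anti-cong k distribʳ ⟩
  ∑anti k (λ x c → ∑anti x (λ a b → X a * (Y b * Z c))) ≡⟨ ∑anti-assoc k (λ a b c → X a * (Y b * Z c)) ⟩
  ∑anti k (λ a y → ∑anti y (λ b c → X a * (Y b * Z c))) ≡⟨ ∑anti-cong k distribˡ ⟩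
  ∑anti k (λ a y → X a * conv Y Z y)                 ≡⟨ sym (conv-∑anti X (conv Y Z) k) ⟩
  conv X (conv Y Z) k                              ∎
  where
  distribʳ : ∀ x c → conv X Y x * Z c ≡ ∑anti x (λ a b → X a * (Y b * Z c))
  distribʳ x c = begin
    conv X Y x * Z c                          ≡⟨ cong (_* Z c) (conv-∑anti X Y x) ⟩
    ∑anti x (λ a b → X a * Y b) * Z c           ≡⟨ *-comm _ (Z c) ⟩
    Z c * ∑anti x (λ a b → X a * Y b)           ≡⟨ *-distribˡ-∑ (suc x) (Z c) (λ a → X a * Y (x ∸ a)) ⟩
    ∑anti x (λ a b → Z c * (X a * Y b))         ≡⟨ ∑anti-cong x (λ a b → trans (*-comm (Z c) (X a * Y b)) (*-assoc (X a) (Y b) (Z c))) ⟩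
    ∑anti x (λ a b → X a * (Y b * Z c))         ∎
  distribˡ : ∀ a y → ∑anti y (λ b c → X a * (Y b * Z c)) ≡ X a * conv Y Z y
  distribˡ a y = trans (sym (*-distribˡ-∑ (suc y) (X a) (λ b → Y b * Z (y ∸ b)))) (cong (X a *_) (sym (conv-∑anti Y Z y)))

conv-scaleʳ : ∀ X Y q → conv X (scale q Y) ≗ scale q (conv X Y)
conv-scaleʳ X Y q k = begin
  conv X (scale q Y) k               ≡⟨ conv-∑anti X (scale q Y) k ⟩
  ∑anti k (λ a b → X a * (q * Y b))  ≡⟨ ∑anti-cong k (λ a b → x*[q*y]≡q*[x*y] (X a) (Y b)) ⟩
  ∑anti k (λ a b → q * (X a * Y b))  ≡⟨ sym (*-distribˡ-∑ (suc k) q (λ a → X a * Y (k ∸ a))) ⟩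
  q * ∑anti k (λ a b → X a * Y b)    ≡⟨ cong (q *_) (sym (conv-∑anti X Y k)) ⟩
  scale q (conv X Y) k               ∎
  where
  x*[q*y]≡q*[x*y] : ∀ x y → x * (q * y) ≡ q * (x * y)
  x*[q*y]≡q*[x*y] x y = trans (sym (*-assoc x q y)) (trans (cong (_* y) (*-comm x q)) (*-assoc q x y))

conv-identityˡ : ∀ D → conv δ₀ D ≗ D
conv-identityˡ D zero    = trans (+-identityʳ (1ℚ * D 0)) (*-identityˡ (D 0))
conv-identityˡ D (suc k) = begin
  conv δ₀ D (suc k)                           ≡⟨ conv-∑anti δ₀ D (suc k) ⟩
  1ℚ * D (suc k) + ∑anti k (λ _ b → 0ℚ * D b)  ≡⟨ cong₂ _+_ (*-identityˡ (D (suc k))) vanish ⟩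
  D (suc k) + 0ℚ                              ≡⟨ +-identityʳ _ ⟩
  D (suc k)                                   ∎
  where
  vanish : ∑anti k (λ _ b → 0ℚ * D b) ≡ 0ℚ
  vanish = trans (∑anti-cong k (λ _ b → *-zeroˡ (D b))) (∑-zero (suc k))

conv-∑Dʳ : ∀ X p Ds → conv X (∑D p Ds) ≗ ∑D p (λ r → conv X (Ds r))
conv-∑Dʳ X p Ds k = begin
  conv X (∑D p Ds) k                          ≡⟨ conv-∑anti X (∑D p Ds) k ⟩
  ∑anti k (λ a b → X a * ∑ p (λ r → Ds r b))  ≡⟨ ∑anti-cong k (λ a b → *-distribˡ-∑ p (X a) (λ r → Ds r b)) ⟩
  ∑anti k (λ a b → ∑ p (λ r → X a * Ds r b))  ≡⟨ ∑-comm (suc k) p (λ a r → X a * Ds r (k ∸ a)) ⟩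
  ∑ p (λ r → ∑anti k (λ a b → X a * Ds r b))  ≡⟨ ∑-cong p (λ r _ → sym (conv-∑anti X (Ds r) k)) ⟩
  ∑D p (λ r → conv X (Ds r)) k                ∎

shift-cong : ∀ s {D E} → D ≗ E → shift s D ≗ shift s E
shift-cong zero    D≗E k       = D≗E k
shift-cong (suc s) D≗E zero    = refl
shift-cong (suc s) D≗E (suc k) = shift-cong s D≗E k

shift-+ : ∀ s t D → shift s (shift t D) ≗ shift (s ℕ.+ t) D
shift-+ zero    t D k       = refl
shift-+ (suc s) t D zero    = refl
shift-+ (suc s) t D (suc k) = shift-+ s t D k

shift-scale : ∀ s q D → shift s (scale q D) ≗ scale q (shift s D)
shift-scale zero    q D k       = refl
shift-scale (suc s) q D zero    = sym (*-zeroʳ q)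
shift-scale (suc s) q D (suc k) = shift-scale s q D k

shift-∑D : ∀ s p Ds → shift s (∑D p Ds) ≗ ∑D p (λ r → shift s (Ds r))
shift-∑D zero    p Ds k       = refl
shift-∑D (suc s) p Ds zero    = sym (∑-zero p)
shift-∑D (suc s) p Ds (suc k) = shift-∑D s p Ds k

conv-shiftʳ : ∀ s X Y → conv X (shift s Y) ≗ shift s (conv X Y)
conv-shiftʳ zero    X Y k       = refl
conv-shiftʳ (suc s) X Y zero    = trans (+-identityʳ (X 0 * 0ℚ)) (*-zeroʳ (X 0))
conv-shiftʳ (suc s) X Y (suc k) = begin
  conv X (shift (suc s) Y) (suc k)
    ≡⟨ conv-∑anti X (shift (suc s) Y) (suc k) ⟩
  ∑ (suc (suc k)) (λ a → X a * shift (suc s) Y (suc k ∸ a))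
    ≡⟨ ∑-snoc (suc k) (λ a → X a * shift (suc s) Y (suc k ∸ a)) ⟩
  ∑ (suc k) (λ a → X a * shift (suc s) Y (suc k ∸ a)) + X (suc k) * shift (suc s) Y (suc k ∸ suc k)
    ≡⟨ cong₂ _+_ (∑-cong (suc k) (λ a a<1+k → cong (λ b → X a * shift (suc s) Y b) (ℕ.+-∸-assoc 1 (ℕ.≤-pred a<1+k))))
                 (cong (λ b → X (suc k) * shift (suc s) Y b) (ℕ.n∸n≡0 k)) ⟩
  ∑anti k (λ a b → X a * shift s Y b) + X (suc k) * 0ℚ
    ≡⟨ cong₂ _+_ (sym (conv-∑anti X (shift s Y) k)) (*-zeroʳ (X (suc k))) ⟩
  conv X (shift s Y) k + 0ℚ
    ≡⟨ trans (+-identityʳ _) (conv-shiftʳ s X Y k) ⟩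
  shift s (conv X Y) k ∎

get-++ˡ : ∀ xs ys {i} → i < length xs → get (xs ++ ys) i ≡ get xs i
get-++ˡ (x ∷ xs) ys {zero}  _         = refl
get-++ˡ (x ∷ xs) ys {suc i} (s≤s i<n) = get-++ˡ xs ys i<n

get-++-length : ∀ xs y ys → get (xs ++ y ∷ ys) (length xs) ≡ y
get-++-length []       y ys = refl
get-++-length (x ∷ xs) y ys = get-++-length xs y ys

module History (step : ℕ → List Dist → Dist) (hist : ℕ → List Dist)
               (hist-zero : hist 0 ≡ [])
               (hist-suc : ∀ n → hist (suc n) ≡ hist n ++ [ step n (hist n) ]) where

  length-hist : ∀ n → length (hist n) ≡ n
  length-hist zero    = cong length hist-zero
  length-hist (suc n) = begin
    length (hist (suc n))                   ≡⟨ cong length (hist-suc n) ⟩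
    length (hist n ++ [ step n (hist n) ])  ≡⟨ length-++ (hist n) ⟩
    length (hist n) ℕ.+ 1                   ≡⟨ ℕ.+-comm (length (hist n)) 1 ⟩
    suc (length (hist n))                   ≡⟨ cong suc (length-hist n) ⟩
    suc n                                   ∎

  get-hist : ∀ {n i} → i < n → get (hist n) i ≡ step i (hist i)
  get-hist {suc n} {i} i<1+n with ℕ.m≤n⇒m<n∨m≡n (ℕ.≤-pred i<1+n)
  ... | inj₁ i<n = begin
    get (hist (suc n)) i                   ≡⟨ cong (λ h → get h i) (hist-suc n) ⟩
    get (hist n ++ [ step n (hist n) ]) i  ≡⟨ get-++ˡ (hist n) _ (subst (i <_) (sym (length-hist n)) i<n) ⟩
    get (hist n) i                         ≡⟨ get-hist i<n ⟩
    step i (hist i)                        ∎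
  ... | inj₂ refl = begin
    get (hist (suc i)) i                                   ≡⟨ cong₂ get (hist-suc i) (sym (length-hist i)) ⟩
    get (hist i ++ [ step i (hist i) ]) (length (hist i))  ≡⟨ get-++-length (hist i) _ [] ⟩
    step i (hist i)                                        ∎

get-histQ : ∀ {n i} → i < n → get (histQ n) i ≡ lawC i
get-histQ = History.get-hist stepQ histQ refl (λ _ → refl)

get-histD : ∀ {n i} → i < n → get (histD n) i ≡ lawC₂ i
get-histD = History.get-hist stepD histD refl (λ _ → refl)

ι : ℕ → ℚ
ι p = ℤ.+ p / 1

toℚᵘ-/ : ∀ a b → toℚᵘ (ℤ.+ a / suc b) ℚᵘ.≃ ℚᵘ.mkℚᵘ (ℤ.+ a) b
toℚᵘ-/ a b = toℚᵘ-fromℚᵘ (ℚᵘ.mkℚᵘ (ℤ.+ a) b)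

/-≡ : ∀ a b c d → a ℕ.* suc d ≡ c ℕ.* suc b → ℤ.+ a / suc b ≡ ℤ.+ c / suc d
/-≡ a b c d ad≡cb = fromℚᵘ-cong {ℚᵘ.mkℚᵘ (ℤ.+ a) b} {ℚᵘ.mkℚᵘ (ℤ.+ c) d} (ℚᵘ.*≡* (begin
  ℤ.+ a ℤ.* ℤ.+ suc d  ≡⟨ ℤ.pos-* a (suc d) ⟨
  ℤ.+ (a ℕ.* suc d)    ≡⟨ cong ℤ.+_ ad≡cb ⟩
  ℤ.+ (c ℕ.* suc b)    ≡⟨ ℤ.pos-* c (suc b) ⟩
  ℤ.+ c ℤ.* ℤ.+ suc b  ∎))

/-*-/ : ∀ a b c d → (ℤ.+ a / suc b) * (ℤ.+ c / suc d) ≡ ℤ.+ (a ℕ.* c) / (suc b ℕ.* suc d)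
/-*-/ a b c d = toℚᵘ-injective (ℚᵘ.≃-trans (toℚᵘ-homo-* (ℤ.+ a / suc b) (ℤ.+ c / suc d))
  (ℚᵘ.≃-trans (ℚᵘ.*-cong (toℚᵘ-/ a b) (toℚᵘ-/ c d))
  (ℚᵘ.≃-trans (ℚᵘ.*≡* (cong (ℤ._* ℤ.+ (suc b ℕ.* suc d)) (sym (ℤ.pos-* a c))))
              (ℚᵘ.≃-sym (toℚᵘ-/ (a ℕ.* c) (d ℕ.+ b ℕ.* suc d))))))

ι-+ : ∀ a b → ι (a ℕ.+ b) ≡ ι a + ι b
ι-+ a b = sym (toℚᵘ-injective (ℚᵘ.≃-trans (toℚᵘ-homo-+ (ι a) (ι b))
  (ℚᵘ.≃-trans (ℚᵘ.+-cong (toℚᵘ-/ a 0) (toℚᵘ-/ b 0))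
  (ℚᵘ.≃-trans (ℚᵘ.*≡* (trans (ℤ.*-identityʳ _) numerator)) (ℚᵘ.≃-sym (toℚᵘ-/ (a ℕ.+ b) 0))))))
  where
  numerator : ℤ.+ a ℤ.* ℤ.+ 1 ℤ.+ ℤ.+ b ℤ.* ℤ.+ 1 ≡ ℤ.+ (a ℕ.+ b) ℤ.* ℤ.+ 1
  numerator = begin
    ℤ.+ a ℤ.* ℤ.+ 1 ℤ.+ ℤ.+ b ℤ.* ℤ.+ 1  ≡⟨ cong₂ ℤ._+_ (ℤ.*-identityʳ (ℤ.+ a)) (ℤ.*-identityʳ (ℤ.+ b)) ⟩
    ℤ.+ a ℤ.+ ℤ.+ b                      ≡⟨ ℤ.pos-+ a b ⟨
    ℤ.+ (a ℕ.+ b)                        ≡⟨ ℤ.*-identityʳ _ ⟨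
    ℤ.+ (a ℕ.+ b) ℤ.* ℤ.+ 1              ∎

ι-*-1/ : ∀ b → ι (suc b) * (ℤ.+ 1 / suc b) ≡ 1ℚ
ι-*-1/ b = trans (/-*-/ (suc b) 0 1 b) (/-≡ (suc b ℕ.* 1) (b ℕ.+ 0) 1 0 (cross b))
  where
  cross : ∀ b → suc b ℕ.* 1 ℕ.* 1 ≡ 1 ℕ.* suc (b ℕ.+ 0)
  cross = solve-∀

ι-*-1/-cancelˡ : ∀ b x → ι (suc b) * ((ℤ.+ 1 / suc b) * x) ≡ x
ι-*-1/-cancelˡ b x = begin
  ι (suc b) * ((ℤ.+ 1 / suc b) * x)  ≡⟨ *-assoc (ι (suc b)) _ x ⟨
  (ι (suc b) * (ℤ.+ 1 / suc b)) * x  ≡⟨ cong (_* x) (ι-*-1/ b) ⟩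
  1ℚ * x                             ≡⟨ *-identityˡ x ⟩
  x                                  ∎

2/[m*n]-split : ∀ a b → ℤ.+ 2 / (suc a ℕ.* suc b) ≡ ι 2 * ((ℤ.+ 1 / suc a) * (ℤ.+ 1 / suc b))
2/[m*n]-split a b = sym (trans (cong (ι 2 *_) (/-*-/ 1 a 1 b))
                   (trans (/-*-/ 2 0 1 c) (/-≡ (2 ℕ.* 1) (c ℕ.+ 0 ℕ.* suc c) 2 c (cross c))))
  where
  c : ℕ
  c = b ℕ.+ a ℕ.* suc b
  cross : ∀ c → 2 ℕ.* 1 ℕ.* suc c ≡ 2 ℕ.* suc (c ℕ.+ 0 ℕ.* suc c)
  cross = solve-∀

1+b*x≡2*y⇒2/[1+a][1+b]*y≡1/[1+a]*x : ∀ a b {x y} → ι (suc b) * x ≡ ι 2 * y →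
               (ℤ.+ 2 / (suc a ℕ.* suc b)) * y ≡ (ℤ.+ 1 / suc a) * x
1+b*x≡2*y⇒2/[1+a][1+b]*y≡1/[1+a]*x a b {x} {y} bx≡2y = begin
  (ℤ.+ 2 / (suc a ℕ.* suc b)) * y    ≡⟨ cong (_* y) (2/[m*n]-split a b) ⟩
  (ι 2 * (u * v)) * y                ≡⟨ solve 4 (λ u v w z → (w :* (u :* v)) :* z := (u :* v) :* (w :* z)) refl u v (ι 2) y ⟩
  (u * v) * (ι 2 * y)                ≡⟨ cong ((u * v) *_) bx≡2y ⟨
  (u * v) * (ι (suc b) * x)          ≡⟨ solve 4 (λ u v w z → (u :* v) :* (w :* z) := u :* (w :* (v :* z))) refl u v (ι (suc b)) x ⟩
  u * (ι (suc b) * (v * x))          ≡⟨ cong (u *_) (ι-*-1/-cancelˡ b x) ⟩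
  u * x                              ∎
  where
  u v : ℚ
  u = ℤ.+ 1 / suc a
  v = ℤ.+ 1 / suc b

∑-symmetric-weight : ∀ m (T : ℕ → ℚ) → (∀ t → t ≤ m → T (m ∸ t) ≡ T t) →
                     ι m * ∑ (suc m) T ≡ ι 2 * ∑ (suc m) (λ t → ι (m ∸ t) * T t)
∑-symmetric-weight m T T-symmetric = begin
  ι m * ∑ (suc m) T                           ≡⟨ *-distribˡ-∑ (suc m) (ι m) T ⟩
  ∑ (suc m) (λ t → ι m * T t)                 ≡⟨ ∑-cong (suc m) (λ t t<1+m → split t (ℕ.≤-pred t<1+m)) ⟩
  ∑ (suc m) (λ t → W t + ι t * T t)           ≡⟨ ∑-distrib-+ (suc m) W (λ t → ι t * T t) ⟩
  ∑ (suc m) W + ∑ (suc m) (λ t → ι t * T t)   ≡⟨ cong (∑ (suc m) W +_) mirror ⟩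
  ∑ (suc m) W + ∑ (suc m) W                   ≡⟨ double (∑ (suc m) W) ⟨
  ι 2 * ∑ (suc m) W                           ∎
  where
  W : ℕ → ℚ
  W t = ι (m ∸ t) * T t
  split : ∀ t → t ≤ m → ι m * T t ≡ W t + ι t * T t
  split t t≤m = begin
    ι m * T t                   ≡⟨ cong (λ s → ι s * T t) (ℕ.m∸n+n≡m t≤m) ⟨
    ι (m ∸ t ℕ.+ t) * T t       ≡⟨ cong (_* T t) (ι-+ (m ∸ t) t) ⟩
    (ι (m ∸ t) + ι t) * T t     ≡⟨ *-distribʳ-+ (T t) (ι (m ∸ t)) (ι t) ⟩
    W t + ι t * T t             ∎
  mirror : ∑ (suc m) (λ t → ι t * T t) ≡ ∑ (suc m) W
  mirror = trans (∑-reverse m (λ t → ι t * T t))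
                 (∑-cong (suc m) (λ t t<1+m → cong (ι (m ∸ t) *_) (T-symmetric t (ℕ.≤-pred t<1+m))))
  double : ∀ x → ι 2 * x ≡ x + x
  double x = trans (*-distribʳ-+ x 1ℚ 1ℚ) (cong₂ _+_ (*-identityˡ x) (*-identityˡ x))

sumD-map : ∀ {A : Set} (g : A → Dist) xs k → sumD (map g xs) k ≡ sumℚ (map (λ x → g x k) xs)
sumD-map g xs k = cong sumℚ (sym (map-∘ xs))

stepQ-expand : ∀ q h k → stepQ (suc (suc q)) h k ≡
  (ℤ.+ 1 / suc (suc q)) * ∑ (suc (suc q)) (λ t → shift (suc q) (conv (get h t) (get h (suc q ∸ t))) k)
stepQ-expand q h k = cong ((ℤ.+ 1 / suc (suc q)) *_)
  (trans (sumD-map term (between 1 (suc (suc (suc q)))) k)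
         (sumℚ-map-between 1 (suc (suc (suc q))) (λ u → term u k)))
  where
  term : ℕ → Dist
  term u = shift (suc q) (conv (get h (u ∸ 1)) (get h (suc (suc q) ∸ u)))

stepD-expand : ∀ q h k → stepD (suc (suc q)) h k ≡
  (ℤ.+ 2 / (suc (suc q) ℕ.* suc q)) *
    ∑ (suc (suc q)) (λ t → ∑ (suc q ∸ t) (λ r →
      shift (2 ℕ.* suc (suc q) ∸ suc t ∸ 2)
        (conv (conv (get h t) (get h (suc (suc t) ℕ.+ r ∸ suc t ∸ 1))) (get h (q ∸ (t ℕ.+ r)))) k))
stepD-expand q h k = cong ((ℤ.+ 2 / (suc (suc q) ℕ.* suc q)) *_)
  (trans (sumD-map term (pairs (suc (suc q))) k)
         (sumℚ-map-pairs (suc (suc q)) (λ ij → term ij k)))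
  where
  term : ℕ × ℕ → Dist
  term (i , j) = shift (2 ℕ.* suc (suc q) ∸ i ∸ 2)
                   (conv (conv (get h (i ∸ 1)) (get h (j ∸ i ∸ 1))) (get h (suc (suc q) ∸ j)))

-- Summands of the two recurrences at the point k: t = U-1 for one pivot, and t = I-1, r = J-I-1
-- for two pivots (with n = q + 2).
quickTerm : ℕ → ℕ → ℕ → ℚ
quickTerm m k t = shift m (conv (lawC t) (lawC (m ∸ t))) k

dualTerm : ℕ → ℕ → ℕ → ℕ → ℚ
dualTerm q k t r = shift (suc q ℕ.+ (q ∸ t)) (conv (conv (lawC t) (lawC r)) (lawC (q ∸ t ∸ r))) k

lawC-expand : ∀ q k → lawC (suc (suc q)) k ≡ (ℤ.+ 1 / suc (suc q)) * ∑ (suc (suc q)) (quickTerm (suc q) k)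
lawC-expand q k = trans (stepQ-expand q (histQ (suc (suc q))) k) (cong ((ℤ.+ 1 / suc (suc q)) *_)
  (∑-cong (suc (suc q)) (λ t t<n → shift-cong (suc q)
    (conv-cong (cong-app (get-histQ t<n)) (cong-app (get-histQ (s≤s (ℕ.m∸n≤m (suc q) t))))) k)))

lawC-rec : ∀ p k → ι p * lawC p k ≡ ∑ p (quickTerm (p ∸ 1) k)
lawC-rec zero          k = *-zeroˡ (δ₀ k)
lawC-rec (suc zero)    k = trans (*-identityˡ (δ₀ k)) (sym (trans (+-identityʳ _) (conv-identityˡ δ₀ k)))
lawC-rec (suc (suc q)) k = trans (cong (ι (suc (suc q)) *_) (lawC-expand q k)) (ι-*-1/-cancelˡ (suc q) _)

quickTerm-symmetric : ∀ m k t → t ≤ m → quickTerm m k (m ∸ t) ≡ quickTerm m k t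
quickTerm-symmetric m k t t≤m = shift-cong m (λ j →
  trans (conv-congʳ (lawC (m ∸ t)) (cong-app (cong lawC (ℕ.m∸[m∸n]≡n t≤m))) j) (conv-comm (lawC (m ∸ t)) (lawC t) j)) k

quickTerm-weighted : ∀ q k t → ι (suc q ∸ t) * quickTerm (suc q) k t ≡ ∑ (suc q ∸ t) (dualTerm q k t)
quickTerm-weighted q k t = begin
  ι p * shift M (conv (lawC t) (lawC p)) k
    ≡⟨ shift-scale M (ι p) (conv (lawC t) (lawC p)) k ⟨
  shift M (scale (ι p) (conv (lawC t) (lawC p))) k
    ≡⟨ shift-cong M (conv-scaleʳ (lawC t) (lawC p) (ι p)) k ⟨
  shift M (conv (lawC t) (scale (ι p) (lawC p))) k
    ≡⟨ shift-cong M (conv-congʳ (lawC t) (lawC-rec p)) k ⟩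
  shift M (conv (lawC t) (∑D p (λ r → shift (p ∸ 1) (splitAt (p ∸ 1) r)))) k
    ≡⟨ shift-cong M (conv-∑Dʳ (lawC t) p (λ r → shift (p ∸ 1) (splitAt (p ∸ 1) r))) k ⟩
  shift M (∑D p (λ r → conv (lawC t) (shift (p ∸ 1) (splitAt (p ∸ 1) r)))) k
    ≡⟨ shift-∑D M p (λ r → conv (lawC t) (shift (p ∸ 1) (splitAt (p ∸ 1) r))) k ⟩
  ∑ p (λ r → shift M (conv (lawC t) (shift (p ∸ 1) (splitAt (p ∸ 1) r))) k)
    ≡⟨ ∑-cong p (λ r _ → reassociate (p ∸ 1) r) ⟩
  ∑ p (λ r → shift (M ℕ.+ (p ∸ 1)) (conv (conv (lawC t) (lawC r)) (lawC (p ∸ 1 ∸ r))) k)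
    ≡⟨ cong (λ s → ∑ p (λ r → shift (M ℕ.+ s) (conv (conv (lawC t) (lawC r)) (lawC (s ∸ r))) k)) p∸1≡q∸t ⟩
  ∑ p (dualTerm q k t) ∎
  where
  M p : ℕ
  M = suc q
  p = suc q ∸ t
  splitAt : ℕ → ℕ → Dist
  splitAt s r = conv (lawC r) (lawC (s ∸ r))
  reassociate : ∀ s r → shift M (conv (lawC t) (shift s (splitAt s r))) k
                      ≡ shift (M ℕ.+ s) (conv (conv (lawC t) (lawC r)) (lawC (s ∸ r))) k
  reassociate s r = begin
    shift M (conv (lawC t) (shift s (splitAt s r))) k  ≡⟨ shift-cong M (conv-shiftʳ s (lawC t) (splitAt s r)) k ⟩
    shift M (shift s (conv (lawC t) (splitAt s r))) k  ≡⟨ shift-+ M s (conv (lawC t) (splitAt s r)) k ⟩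
    shift (M ℕ.+ s) (conv (lawC t) (splitAt s r)) k    ≡⟨ shift-cong (M ℕ.+ s) (conv-assoc (lawC t) (lawC r) (lawC (s ∸ r))) k ⟨
    shift (M ℕ.+ s) (conv (conv (lawC t) (lawC r)) (lawC (s ∸ r))) k ∎
  p∸1≡q∸t : suc q ∸ t ∸ 1 ≡ q ∸ t
  p∸1≡q∸t = trans (ℕ.∸-+-assoc (suc q) t 1) (cong (suc q ∸_) (ℕ.+-comm t 1))

pivot-gap : ∀ t r → suc (suc t) ℕ.+ r ∸ suc t ∸ 1 ≡ r
pivot-gap zero    r = refl
pivot-gap (suc t) r = pivot-gap t r

dual-shift-index : ∀ {q t} → t ≤ q → 2 ℕ.* suc (suc q) ∸ suc t ∸ 2 ≡ suc q ℕ.+ (q ∸ t)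
dual-shift-index {q} {t} t≤q with d , refl ← ℕ.m≤n⇒∃[o]m+o≡n t≤q = begin
  2 ℕ.* suc (suc (t ℕ.+ d)) ∸ suc t ∸ 2                    ≡⟨ ℕ.∸-+-assoc (2 ℕ.* suc (suc (t ℕ.+ d))) (suc t) 2 ⟩
  2 ℕ.* suc (suc (t ℕ.+ d)) ∸ (suc t ℕ.+ 2)                ≡⟨ cong (_∸ (suc t ℕ.+ 2)) (double t d) ⟩
  (suc t ℕ.+ 2) ℕ.+ (suc (t ℕ.+ d) ℕ.+ d) ∸ (suc t ℕ.+ 2)  ≡⟨ ℕ.m+n∸m≡n (suc t ℕ.+ 2) _ ⟩
  suc (t ℕ.+ d) ℕ.+ d                                      ≡⟨ cong (suc (t ℕ.+ d) ℕ.+_) (ℕ.m+n∸m≡n t d) ⟨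
  suc (t ℕ.+ d) ℕ.+ (t ℕ.+ d ∸ t)                          ∎
  where
  double : ∀ t d → 2 ℕ.* suc (suc (t ℕ.+ d)) ≡ (suc t ℕ.+ 2) ℕ.+ (suc (t ℕ.+ d) ℕ.+ d)
  double = solve-∀

lawC₂-expand : ∀ q k → (∀ {i} → i < suc (suc q) → lawC₂ i ≗ lawC i) →
  lawC₂ (suc (suc q)) k ≡
    (ℤ.+ 2 / (suc (suc q) ℕ.* suc q)) * ∑ (suc (suc q)) (λ t → ∑ (suc q ∸ t) (dualTerm q k t))
lawC₂-expand q k IH = trans (stepD-expand q h k) (cong ((ℤ.+ 2 / (suc (suc q) ℕ.* suc q)) *_)
  (∑-cong (suc (suc q)) (λ t t<n → ∑-cong (suc q ∸ t) (λ r r<M∸t → term t r t<n r<M∸t))))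
  where
  h : List Dist
  h = histD (suc (suc q))
  fromHistory : ∀ {i} → i < suc (suc q) → get h i ≗ lawC i
  fromHistory i<n j = trans (cong-app (get-histD i<n) j) (IH i<n j)
  term : ∀ t r → t < suc (suc q) → r < suc q ∸ t →
    shift (2 ℕ.* suc (suc q) ∸ suc t ∸ 2)
      (conv (conv (get h t) (get h (suc (suc t) ℕ.+ r ∸ suc t ∸ 1))) (get h (q ∸ (t ℕ.+ r)))) k
    ≡ dualTerm q k t r
  term t r t<n r<M∸t = begin
    shift (2 ℕ.* suc (suc q) ∸ suc t ∸ 2) X k  ≡⟨ cong (λ s → shift s X k) (dual-shift-index t≤q) ⟩
    shift (suc q ℕ.+ (q ∸ t)) X k              ≡⟨ shift-cong (suc q ℕ.+ (q ∸ t)) (conv-cong (conv-cong (fromHistory t<n) middle) last) k ⟩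
    dualTerm q k t r                           ∎
    where
    X : Dist
    X = conv (conv (get h t) (get h (suc (suc t) ℕ.+ r ∸ suc t ∸ 1))) (get h (q ∸ (t ℕ.+ r)))
    t≤q : t ≤ q
    t≤q = ℕ.≤-pred (ℕ.m∸n≢0⇒n<m (λ M∸t≡0 → ℕ.n≮0 (subst (r <_) M∸t≡0 r<M∸t)))
    middle : get h (suc (suc t) ℕ.+ r ∸ suc t ∸ 1) ≗ lawC r
    middle j = trans (cong (λ i → get h i j) (pivot-gap t r))
                     (fromHistory (ℕ.m<n⇒m<1+n (ℕ.<-≤-trans r<M∸t (ℕ.m∸n≤m (suc q) t))) j)
    last : get h (q ∸ (t ℕ.+ r)) ≗ lawC (q ∸ t ∸ r)
    last j = trans (cong (λ i → get h i j) (sym (ℕ.∸-+-assoc q t r)))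
                   (fromHistory (s≤s (ℕ.m≤n⇒m≤1+n (ℕ.≤-trans (ℕ.m∸n≤m (q ∸ t) r) (ℕ.m∸n≤m q t)))) j)

lawC₂-step : ∀ n → (∀ {i} → i < n → lawC₂ i ≗ lawC i) → lawC₂ n ≗ lawC n
lawC₂-step zero          _  k = refl
lawC₂-step (suc zero)    _  k = refl
lawC₂-step (suc (suc q)) IH k = begin
  lawC₂ (suc (suc q)) k
    ≡⟨ lawC₂-expand q k IH ⟩
  (ℤ.+ 2 / (suc (suc q) ℕ.* suc q)) * ∑ (suc (suc q)) (λ t → ∑ (suc q ∸ t) (dualTerm q k t))
    ≡⟨ 1+b*x≡2*y⇒2/[1+a][1+b]*y≡1/[1+a]*x (suc q) q weighted ⟩
  (ℤ.+ 1 / suc (suc q)) * ∑ (suc (suc q)) (quickTerm (suc q) k)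
    ≡⟨ lawC-expand q k ⟨
  lawC (suc (suc q)) k ∎
  where
  weighted : ι (suc q) * ∑ (suc (suc q)) (quickTerm (suc q) k)
           ≡ ι 2 * ∑ (suc (suc q)) (λ t → ∑ (suc q ∸ t) (dualTerm q k t))
  weighted = trans (∑-symmetric-weight (suc q) (quickTerm (suc q) k) (quickTerm-symmetric (suc q) k))
                   (cong (ι 2 *_) (∑-cong (suc (suc q)) (λ t _ → quickTerm-weighted q k t)))

mainTheorem11 : (n k : ℕ) → lawC₂ n k ≡ lawC n k
mainTheorem11 = <-rec (λ n → lawC₂ n ≗ lawC n) lawC₂-step
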